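{- Let $H=(V,\mathcal{E})$ be a hypergraph and let $h_1,h_2$ be distinct acyclic orientations of $H$. Then there exists $e\in\mathcal{E}$ such that $h_1(e)\ne h_2(e)$ and $(h_1(e),h_2(e))$ is flippable in $h_1$.
   Context: A hypergraph is $H=(V,\mathcal{E})$ with $\mathcal{E}\subseteq 2^V\setminus\{\emptyset\}$. An orientation is a map $h:\mathcal{E}\to V$ with $h(e)\in e$. Its digraph $D_h$ has vertex set $V$ and an arc $(u,v)$ iff some $e\in\mathcal{E}$ has $h(e)=v$ and $u\in e\setminus\{v\}$; $h$ is acyclic if $D_h$ is acyclic. For an acyclic orientation $h$ and distinct $u,v\in V$, the pair $(u,v)$ is flippable in $h$ if the orientation $h'$ defined by $h'(f)=v$ for every $f\in\mathcal{E}$ with $\{u,v\}\subseteq f$ and $h(f)=u$, and $h'(f)=h(f)$ otherwise, is acyclic (i.e. $D_{h'}$ has no directed cycle). -}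

module Defs where

open import Data.Bool using (Bool; T)
open import Data.Nat using (ℕ)
open import Data.Fin using (Fin; _≟_)
open import Data.Fin.Subset using (Subset; _∈_; Nonempty)
open import Data.Fin.Subset.Properties using (_∈?_)
open import Data.Product using (Σ; ∃; _×_; _,_)
open import Relation.Nullary using (¬_; yes; no)
open import Relation.Binary.PropositionalEquality using (_≡_; _≢_)
open import Relation.Binary.Construct.Closure.Transitive using (TransClosure)

record Hypergraph : Set where
  field
    n        : ℕ
    edge     : Subset n → Bool
    nonempty : ∀ (e : Subset n) → T (edge e) → Nonempty e

open Hypergraph public

V : Hypergraph → Set
V H = Fin (n H)

IsEdge : (H : Hypergraph) → Subset (n H) → Set
IsEdge H e = T (edge H e)

-- A head assignment: a map 𝓔 → V (T is proof-irrelevant, so this is a map on edges).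
Heads : Hypergraph → Set
Heads H = (e : Subset (n H)) → IsEdge H e → V H

record Orientation (H : Hypergraph) : Set where
  field
    head    : Heads H
    head∈e  : ∀ e (p : IsEdge H e) → head e p ∈ e

open Orientation public

Arc : (H : Hypergraph) → Heads H → V H → V H → Set
Arc H h u v = Σ (Subset (n H)) λ e → Σ (IsEdge H e) λ p →
  (h e p ≡ v) × (u ∈ e) × (u ≢ v)

AcyclicHeads : (H : Hypergraph) → Heads H → Set
AcyclicHeads H h = ∀ (u : V H) → ¬ TransClosure (Arc H h) u u

Acyclic : (H : Hypergraph) → Orientation H → Set
Acyclic H o = AcyclicHeads H (head o)

flipHeads : (H : Hypergraph) → Heads H → V H → V H → Heads H
flipHeads H h u v f p with u ∈? f | v ∈? f | h f p ≟ u
... | yes _ | yes _ | yes _ = v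
... | _     | _     | _     = h f p

Flippable : (H : Hypergraph) → Orientation H → V H → V H → Set
Flippable H o u v = (u ≢ v) × AcyclicHeads H (flipHeads H (head o) u v)

-- Rank the vertices by r along D_{h₁} and by s against D_{h₂} (arcs of D_{h₂} decrease s).
-- Among the edges on which h₁ and h₂ disagree take one whose h₁-head u has least r, and among
-- those with h₁-head u one whose h₂-head v has least s.  Flipping (u,v) only redirects edges
-- f ∋ u, v with h₁(f) = u towards v, and by the choice of v every member of such an f comes
-- weakly before v in D_{h₂}.  Give level 2 to the vertices y ≠ u with r(y) ≥ r(u), level 1 to
-- the vertices below u that are v or come after v in D_{h₂}, and level 0 to the rest; then
-- (level, r) increases lexicographically along every arc of the flipped digraph, which is
-- therefore acyclic.
module Submission where

open import Data.Bool using (T; true; false; if_then_else_)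
open import Data.Empty using (⊥-elim)
open import Data.Fin using (Fin; _≟_)
open import Data.Fin.Induction using (spo-wellFounded)
open import Data.Fin.Properties using (any?)
open import Data.Fin.Subset using (Subset; _∈_; ∣_∣)
open import Data.Fin.Subset.Properties using (_∈?_; anySubset?; p⊂q⇒∣p∣<∣q∣)
open import Data.List using (List; allFin; filter)
open import Data.List.Extrema.Nat using (argmin; argmin-all; f[argmin]≤f[xs])
open import Data.List.Membership.Propositional.Properties using (∈-filter⁺; ∈-allFin)
open import Data.List.Relation.Unary.All using (lookup)
open import Data.List.Relation.Unary.All.Properties using (all-filter)
open import Data.Nat using (ℕ; _≤_; _<_; _≤?_; _<?_; z≤n; s≤s)
open import Data.Nat.Properties
  using (≤-refl; ≤-reflexive; ≤-trans; <-trans; ≤-<-trans; <⇒≤; <⇒≱; ≰⇒>; ≮⇒≥; <-irrefl;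
         m≤n⇒m<n∨m≡n; <-strictPartialOrder)
open import Data.Product using (Σ; ∃; _×_; _,_; proj₁; proj₂)
open import Data.Product.Relation.Binary.Lex.Strict using (×-strictPartialOrder)
open import Data.Sum using (_⊎_; inj₁; inj₂)
open import Data.Unit using (tt)
open import Data.Vec using (tabulate)
open import Data.Vec.Properties using (lookup∘tabulate; lookup⇒[]=; []=⇒lookup)
open import Function using (_∘_; flip)
open import Induction.WellFounded using (Acc; acc)
open import Level using (Level; 0ℓ)
open import Relation.Binary using (Rel; Decidable; IsStrictPartialOrder; StrictPartialOrder)
open import Relation.Binary.Construct.Closure.Transitive
  using (TransClosure; [_]; _∷_; _∷ʳ_; _++_)
open import Relation.Binary.PropositionalEquality
  using (_≡_; _≢_; refl; sym; trans; cong; subst; subst₂; isEquivalence)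
open import Relation.Nullary using (¬_; Dec; yes; no; does)
open import Relation.Nullary.Decidable as Dec
  using (_×-dec_; _⊎-dec_; ¬?; dec-true; dec-false; decidable-stable)
open import Relation.Unary using (Pred)
import Relation.Unary as U

open import Defs

private
  variable
    a ℓ : Level
    A : Set a

reverse⁺ : {R : Rel A ℓ} {x y : A} → TransClosure (flip R) x y → TransClosure R y x
reverse⁺ [ r ]   = [ r ]
reverse⁺ (r ∷ t) = reverse⁺ t ∷ʳ r

acyclic-flip : {R : Rel A ℓ} → (∀ x → ¬ TransClosure R x x) → ∀ x → ¬ TransClosure (flip R) x x
acyclic-flip acyclic x = acyclic x ∘ reverse⁺

module _ {b ℓ₁ ℓ₂} (S : StrictPartialOrder b ℓ₁ ℓ₂) {R : Rel A ℓ} where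
  open StrictPartialOrder S using (Carrier; irrefl; module Eq)
    renaming (_<_ to _⊏_; trans to ⊏-trans)

  acyclic-by-potential : (φ : A → Carrier) → (∀ {x y} → R x y → φ x ⊏ φ y) →
                         ∀ x → ¬ TransClosure R x x
  acyclic-by-potential φ φ-mono x t = irrefl Eq.refl (φ-mono⁺ t)
    where
    φ-mono⁺ : ∀ {x y} → TransClosure R x y → φ x ⊏ φ y
    φ-mono⁺ [ r ]   = φ-mono r
    φ-mono⁺ (r ∷ t) = ⊏-trans (φ-mono r) (φ-mono⁺ t)

module Rank {n} {R : Rel (Fin n) ℓ} (R? : Decidable R)
            (acyclic : ∀ x → ¬ TransClosure R x x) where

  private
    _⁺_ : Rel (Fin n) ℓ
    _⁺_ = TransClosure R

    ⁺-isStrictPartialOrder : IsStrictPartialOrder _≡_ _⁺_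
    ⁺-isStrictPartialOrder = record
      { isEquivalence = isEquivalence
      ; irrefl        = λ { refl → acyclic _ }
      ; trans         = _++_
      ; <-resp-≈      = (λ { refl t → t }) , (λ { refl t → t })
      }

    LastStep : Fin n → Fin n → Fin n → Set ℓ
    LastStep y x z = R z x × (y ≡ z ⊎ y ⁺ z)

    split : ∀ {y x} → y ⁺ x → ∃ (LastStep y x)
    split {y} [ r ] = y , r , inj₁ refl
    split (r ∷ t) with split t
    ... | z , r′ , inj₁ refl = z , r′ , inj₂ [ r ]
    ... | z , r′ , inj₂ t′   = z , r′ , inj₂ (r ∷ t′)

    join : ∀ {y x} → ∃ (LastStep y x) → y ⁺ x
    join (_ , r , inj₁ refl) = [ r ]
    join (_ , r , inj₂ t)    = t ∷ʳ r

    reachable-acc? : ∀ y x → Acc _⁺_ x → Dec (y ⁺ x)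
    reachable-acc? y x (acc rec) = Dec.map′ join split (any? lastStep?)
      where
      lastStep? : ∀ z → Dec (LastStep y x z)
      lastStep? z with R? z x
      ... | no ¬r = no (¬r ∘ proj₁)
      ... | yes r = Dec.map′ (r ,_) proj₂ (y ≟ z ⊎-dec reachable-acc? y z (rec [ r ]))

  reachable? : Decidable _⁺_
  reachable? y x = reachable-acc? y x (spo-wellFounded ⁺-isStrictPartialOrder x)

  predecessors : Fin n → Subset n
  predecessors x = tabulate (λ y → does (reachable? y x))

  ∈-predecessors⁺ : ∀ {y x} → y ⁺ x → y ∈ predecessors x
  ∈-predecessors⁺ {y} {x} t =
    lookup⇒[]= y _ (trans (lookup∘tabulate _ y) (dec-true (reachable? y x) t))

  ∈-predecessors⁻ : ∀ {y x} → y ∈ predecessors x → y ⁺ x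
  ∈-predecessors⁻ {y} {x} y∈
    with reachable? y x | trans (sym (lookup∘tabulate _ y)) ([]=⇒lookup y∈)
  ... | yes t | _  = t
  ... | no _  | ()

  rank : Fin n → ℕ
  rank x = ∣ predecessors x ∣

  rank-mono : ∀ {x y} → R x y → rank x < rank y
  rank-mono {x} {y} r = p⊂q⇒∣p∣<∣q∣
    ( (λ z∈ → ∈-predecessors⁺ (∈-predecessors⁻ z∈ ∷ʳ r))
    , x , ∈-predecessors⁺ [ r ] , acyclic x ∘ ∈-predecessors⁻ )

minimal-witness : ∀ {n p} {P : Pred (Fin n) p} → U.Decidable P → (f : Fin n → ℕ) →
                  ∃ P → ∃ λ x → P x × (∀ {y} → P y → f x ≤ f y)
minimal-witness {n} P? f (x₀ , Px₀) =
  m , argmin-all f Px₀ (all-filter P? (allFin n)) ,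
  λ Py → lookup (f[argmin]≤f[xs] x₀ xs) (∈-filter⁺ P? (∈-allFin _) Py)
  where
  xs : List (Fin n)
  xs = filter P? (allFin n)
  m : Fin n
  m = argmin f x₀ xs

ΣT? : ∀ {b} {Q : T b → Set} → (∀ p → Dec (Q p)) → Dec (Σ (T b) Q)
ΣT? {false} Q? = no proj₁
ΣT? {true}  Q? = Dec.map′ (tt ,_) proj₂ (Q? tt)

Arc? : (H : Hypergraph) (h : Heads H) → ∀ x y → Dec (Arc H h x y)
Arc? H h x y = anySubset? λ e → ΣT? λ p → h e p ≟ y ×-dec x ∈? e ×-dec ¬? (x ≟ y)

arc-to-head : ∀ {H} (h : Orientation H) {e x} (p : IsEdge H e) →
              x ∈ e → x ≢ head h e p → Arc H (head h) x (head h e p)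
arc-to-head h {e} p x∈e x≢h = e , p , refl , x∈e , x≢h

module Disagreements (H : Hypergraph) (h₁ h₂ : Orientation H) where

  Disagreement : V H → V H → Set
  Disagreement x y = Σ (Subset (n H)) λ e → Σ (IsEdge H e) λ p →
    head h₁ e p ≢ head h₂ e p × head h₁ e p ≡ x × head h₂ e p ≡ y

  disagreement? : ∀ x y → Dec (Disagreement x y)
  disagreement? x y = anySubset? λ e → ΣT? λ p →
    ¬? (head h₁ e p ≟ head h₂ e p) ×-dec head h₁ e p ≟ x ×-dec head h₂ e p ≟ y

  disagreement-exists : ¬ (∀ e p → head h₁ e p ≡ head h₂ e p) → ∃ λ x → ∃ (Disagreement x)
  disagreement-exists h₁≢h₂ with anySubset? (λ e → ΣT? λ p → ¬? (head h₁ e p ≟ head h₂ e p))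
  ... | yes (e , p , h≢) = _ , _ , e , p , h≢ , refl , refl
  ... | no none = ⊥-elim (h₁≢h₂ λ e p →
        decidable-stable (head h₁ e p ≟ head h₂ e p) λ h≢ → none (e , p , h≢))

  module FlipAcyclic
    (r s : V H → ℕ)
    (r-mono : ∀ {x y} → Arc H (head h₁) x y → r x < r y)
    (s-anti : ∀ {x y} → Arc H (head h₂) x y → s y < s x)
    {u v : V H} (uv : Disagreement u v)
    (u-minimal : ∀ {x} → ∃ (Disagreement x) → r u ≤ r x)
    (v-minimal : ∀ {y} → Disagreement u y → s v ≤ s y)
    where

    h₁′ : Heads H
    h₁′ = flipHeads H (head h₁) u v

    data FlipView (f : Subset (n H)) (p : IsEdge H f) (w : V H) : Set where
      flipped   : u ∈ f → v ∈ f → head h₁ f p ≡ u → w ≡ v → FlipView f p w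
      unchanged : w ≡ head h₁ f p → (u ∈ f → v ∈ f → head h₁ f p ≢ u) → FlipView f p w

    flipView : ∀ f p → FlipView f p (h₁′ f p)
    flipView f p with u ∈? f | v ∈? f | head h₁ f p ≟ u
    ... | yes u∈f | yes v∈f | yes h≡u = flipped u∈f v∈f h≡u refl
    ... | yes _   | yes _   | no h≢u  = unchanged refl λ _ _ → h≢u
    ... | yes _   | no v∉f  | _       = unchanged refl λ _ v∈f → ⊥-elim (v∉f v∈f)
    ... | no u∉f  | _       | _       = unchanged refl λ u∈f → ⊥-elim (u∉f u∈f)

    r[v]<r[u] : r v < r u
    r[v]<r[u] = let (e , p , h≢ , h₁≡u , h₂≡v) = uv in
      subst₂ (λ a b → r a < r b) h₂≡v h₁≡u
        (r-mono (arc-to-head h₁ p (head∈e h₂ e p) (h≢ ∘ sym)))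

    s[v]<s[u] : s v < s u
    s[v]<s[u] = let (e , p , h≢ , h₁≡u , h₂≡v) = uv in
      subst₂ (λ a b → s a < s b) h₂≡v h₁≡u
        (s-anti (arc-to-head h₂ p (head∈e h₁ e p) h≢))

    s-head≤member : ∀ {f x} (p : IsEdge H f) → x ∈ f → s (head h₂ f p) ≤ s x
    s-head≤member {f} {x} p x∈f with x ≟ head h₂ f p
    ... | yes refl = ≤-refl
    ... | no x≢h   = <⇒≤ (s-anti (arc-to-head h₂ p x∈f x≢h))

    s[v]≤s-on-u-edge : ∀ {f x} (p : IsEdge H f) → head h₁ f p ≡ u → x ∈ f → s v ≤ s x
    s[v]≤s-on-u-edge {f} p h₁≡u x∈f = ≤-trans s[v]≤s[h₂] (s-head≤member p x∈f)
      where
      s[v]≤s[h₂] : s v ≤ s (head h₂ f p)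
      s[v]≤s[h₂] with head h₁ f p ≟ head h₂ f p
      ... | yes h₁≡h₂ = <⇒≤ (subst (λ w → s v < s w) (trans (sym h₁≡u) h₁≡h₂) s[v]<s[u])
      ... | no h₁≢h₂  = v-minimal (f , p , h₁≢h₂ , h₁≡u , refl)

    Upper : V H → Set
    Upper y = y ≢ u × r u ≤ r y

    Middle : V H → Set
    Middle y = r y < r u × (y ≡ v ⊎ s y < s v)

    upper? : ∀ y → Dec (Upper y)
    upper? y = ¬? (y ≟ u) ×-dec r u ≤? r y

    middle? : ∀ y → Dec (Middle y)
    middle? y = r y <? r u ×-dec (y ≟ v ⊎-dec s y <? s v)

    below⇒¬upper : ∀ {y} → r y < r u → ¬ Upper y
    below⇒¬upper y<u (_ , u≤y) = <⇒≱ y<u u≤y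

    -- Abstract, so that a `with` on one of the tests made by `level` leaves goals about it intact.
    abstract
      level : V H → ℕ
      level y = if does (upper? y) then 2 else if does (middle? y) then 1 else 0

      level-upper : ∀ {y} → Upper y → level y ≡ 2
      level-upper {y} up rewrite dec-true (upper? y) up = refl

      level-middle : ∀ {y} → Middle y → level y ≡ 1
      level-middle {y} mid@(y<u , _)
        rewrite dec-false (upper? y) (below⇒¬upper y<u) | dec-true (middle? y) mid = refl

      level-bottom : ∀ {y} → ¬ Upper y → ¬ Middle y → level y ≡ 0
      level-bottom {y} ¬up ¬mid
        rewrite dec-false (upper? y) ¬up | dec-false (middle? y) ¬mid = refl

      level≤2 : ∀ y → level y ≤ 2
      level≤2 y with does (upper? y) | does (middle? y)
      ... | true  | _     = ≤-refl
      ... | false | true  = s≤s z≤n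
      ... | false | false = z≤n

      level≤1 : ∀ {y} → ¬ Upper y → level y ≤ 1
      level≤1 {y} ¬up rewrite dec-false (upper? y) ¬up with does (middle? y)
      ... | true  = ≤-refl
      ... | false = z≤n

    level-u : level u ≡ 0
    level-u = level-bottom (λ (u≢u , _) → u≢u refl) (λ (u<u , _) → <-irrefl refl u<u)

    level-bottom′ : ∀ {y} → r y < r u → y ≢ v → s v ≤ s y → level y ≡ 0
    level-bottom′ y<u y≢v v≤y = level-bottom (below⇒¬upper y<u)
      λ { (_ , inj₁ y≡v) → y≢v y≡v ; (_ , inj₂ y<v) → <⇒≱ y<v v≤y }

    level-on-u-edge : ∀ {f x} (p : IsEdge H f) → head h₁ f p ≡ u → x ∈ f → x ≢ v → level x ≡ 0
    level-on-u-edge {f} {x} p h₁≡u x∈f x≢v with x ≟ u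
    ... | yes x≡u = subst (λ w → level w ≡ 0) (sym x≡u) level-u
    ... | no x≢u  = level-bottom′ x<u x≢v (s[v]≤s-on-u-edge p h₁≡u x∈f)
      where
      x<u : r x < r u
      x<u = subst (λ w → r x < r w) h₁≡u
              (r-mono (arc-to-head h₁ p x∈f λ x≡h → x≢u (trans x≡h h₁≡u)))

    -- An edge whose h₁-head lies below u agrees with h₂ by the choice of u, so in D_{h₂} too
    -- its members come before its head.
    level-into-bottom : ∀ {f x} (p : IsEdge H f) → x ∈ f → x ≢ head h₁ f p →
                        r (head h₁ f p) < r u → ¬ Middle (head h₁ f p) → level x ≡ 0
    level-into-bottom {f} {x} p x∈f x≢y y<u ¬mid with head h₁ f p ≟ head h₂ f p
    ... | no h₁≢h₂  = ⊥-elim (<⇒≱ y<u (u-minimal (_ , f , p , h₁≢h₂ , refl , refl)))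
    ... | yes h₁≡h₂ =
      level-bottom′ (<-trans x<y y<u) (λ x≡v → <-irrefl (cong s (sym x≡v)) v<x) (<⇒≤ v<x)
      where
      x<y : r x < r (head h₁ f p)
      x<y = r-mono (arc-to-head h₁ p x∈f x≢y)
      v≤y : s v ≤ s (head h₁ f p)
      v≤y with s (head h₁ f p) <? s v
      ... | yes y<v = ⊥-elim (¬mid (y<u , inj₂ y<v))
      ... | no ¬y<v = ≮⇒≥ ¬y<v
      v<x : s v < s x
      v<x = ≤-<-trans v≤y (subst (λ w → s w < s x) (sym h₁≡h₂)
              (s-anti (arc-to-head h₂ p x∈f (λ x≡h → x≢y (trans x≡h (sym h₁≡h₂))))))

    level-mono-unflipped : ∀ {f x} (p : IsEdge H f) → x ∈ f → x ≢ head h₁ f p →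
                           (u ∈ f → v ∈ f → head h₁ f p ≢ u) → level x ≤ level (head h₁ f p)
    level-mono-unflipped {f} {x} p x∈f x≢y unflipped
      with upper? (head h₁ f p) | head h₁ f p ≟ u
    ... | yes up | _       = subst (level x ≤_) (sym (level-upper up)) (level≤2 x)
    ... | no _   | yes y≡u =
      subst (_≤ level (head h₁ f p)) (sym (level-on-u-edge p y≡u x∈f x≢v)) z≤n
      where
      x≢v : x ≢ v
      x≢v x≡v = unflipped (subst (_∈ f) y≡u (head∈e h₁ f p)) (subst (_∈ f) x≡v x∈f) y≡u
    ... | no ¬up | no y≢u  = below (≰⇒> λ u≤y → ¬up (y≢u , u≤y)) (middle? (head h₁ f p))
      where
      below : r (head h₁ f p) < r u → Dec (Middle (head h₁ f p)) → level x ≤ level (head h₁ f p)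
      below y<u (yes mid) = subst (level x ≤_) (sym (level-middle mid))
        (level≤1 (below⇒¬upper (<-trans (r-mono (arc-to-head h₁ p x∈f x≢y)) y<u)))
      below y<u (no ¬mid) =
        ≤-reflexive (trans (level-into-bottom p x∈f x≢y y<u ¬mid) (sym (level-bottom ¬up ¬mid)))

    potential : V H → ℕ × ℕ
    potential y = level y , r y

    Lex : StrictPartialOrder 0ℓ 0ℓ 0ℓ
    Lex = ×-strictPartialOrder <-strictPartialOrder <-strictPartialOrder
    open StrictPartialOrder Lex using () renaming (_<_ to _⊏_)

    arc-ascends : ∀ {x y} → Arc H h₁′ x y → potential x ⊏ potential y
    arc-ascends {x} {y} (f , p , h′≡y , x∈f , x≢y) with flipView f p
    ... | flipped u∈f v∈f h₁≡u h′≡v = inj₁ (subst₂ _<_ (sym level-x) (sym level-y) (s≤s z≤n))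
      where
      y≡v : y ≡ v
      y≡v = trans (sym h′≡y) h′≡v
      level-x : level x ≡ 0
      level-x = level-on-u-edge p h₁≡u x∈f (λ x≡v → x≢y (trans x≡v (sym y≡v)))
      level-y : level y ≡ 1
      level-y = level-middle (subst (λ w → r w < r u) (sym y≡v) r[v]<r[u] , inj₁ y≡v)
    ... | unchanged h′≡h₁ unflipped =
      subst (λ w → potential x ⊏ potential w) h₁≡y
        (ascend (level-mono-unflipped p x∈f x≢h₁ unflipped) (r-mono (arc-to-head h₁ p x∈f x≢h₁)))
      where
      h₁≡y : head h₁ f p ≡ y
      h₁≡y = trans (sym h′≡h₁) h′≡y
      x≢h₁ : x ≢ head h₁ f p
      x≢h₁ x≡h = x≢y (trans x≡h h₁≡y)
      ascend : ∀ {x y} → level x ≤ level y → r x < r y → potential x ⊏ potential y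
      ascend lx≤ly rx<ry with m≤n⇒m<n∨m≡n lx≤ly
      ... | inj₁ lx<ly = inj₁ lx<ly
      ... | inj₂ lx≡ly = inj₂ (lx≡ly , rx<ry)

    flipped-acyclic : AcyclicHeads H h₁′
    flipped-acyclic = acyclic-by-potential Lex potential arc-ascends

lemma6 : (H : Hypergraph) (h₁ h₂ : Orientation H) →
    Acyclic H h₁ → Acyclic H h₂ →
    ¬ (∀ (e : Subset (n H)) (p : IsEdge H e) → head h₁ e p ≡ head h₂ e p) →
    Σ (Subset (n H)) λ e → Σ (IsEdge H e) λ p →
    (head h₁ e p ≢ head h₂ e p) × Flippable H h₁ (head h₁ e p) (head h₂ e p)
lemma6 H h₁ h₂ acyclic₁ acyclic₂ h₁≢h₂ =
  let (u , (w , uw) , u-minimal) = minimal-witness (any? ∘ disagreement?) r (disagreement-exists h₁≢h₂)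
      (v , uv , v-minimal)       = minimal-witness (disagreement? u) s (w , uw)
      (e , p , h≢ , h₁≡u , h₂≡v) = uv
  in e , p , h≢ , h≢ ,
     subst₂ (λ a b → AcyclicHeads H (flipHeads H (head h₁) a b)) (sym h₁≡u) (sym h₂≡v)
       (FlipAcyclic.flipped-acyclic r s R₁.rank-mono R₂.rank-mono uv u-minimal v-minimal)
  where
  open Disagreements H h₁ h₂
  module R₁ = Rank (Arc? H (head h₁)) acyclic₁
  module R₂ = Rank {R = flip (Arc H (head h₂))} (flip (Arc? H (head h₂))) (acyclic-flip acyclic₂)
  r s : V H → ℕ
  r = R₁.rank
  s = R₂.rank
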